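{- Let $\mathcal H=\{P_4, C_4, S_4\}$. Then $\chi'_{\mathcal H}(n)=\frac{3}{4}n+o(n)$ as $n\to\infty$.
   Context: For a graph $G$ and a set $\mathcal H$ of small graphs, an $\mathcal H$-avoiding bipartite partition of $G$ is a collection of bipartite graphs $G_1,\dots,G_k$ (subgraphs of $G$) whose edge sets are pairwise disjoint with union $E(G)$, such that no $G_i$ contains any member of $\mathcal H$ as an induced subgraph. $\chi'_{\mathcal H}(G)$ is the smallest $k$ for which such a partition with $k$ graphs exists, and $\chi'_{\mathcal H}(n):=\chi'_{\mathcal H}(K_n)$, where $K_n$ is the complete graph on $n$ vertices. $P_4$ is the path on 4 vertices, $C_4$ the cycle on 4 vertices, and $S_4$ the star on 4 vertices ($K_{1,3}$). -}

module Defs where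

open import Data.Nat using (ℕ; zero; suc; _+_; _*_; _≤_)
open import Data.Fin using (Fin; zero; suc)
open import Data.Bool using (Bool; true; false; _∨_; T)
open import Data.Product using (Σ; ∃; _×_; _,_)
open import Data.Empty using (⊥)
open import Relation.Nullary using (¬_)
open import Relation.Binary.PropositionalEquality using (_≡_; _≢_)
open import Function.Definitions using (Injective)

-- An edge colouring of K_n with k colours: colour classes are the graphs G_1..G_k.
-- The value c x x on the diagonal is irrelevant (loops are not edges).
Colouring : ℕ → ℕ → Set
Colouring n k = Σ (Fin n → Fin n → Fin k) λ c → ∀ x y → c x y ≡ c y x

Adj : ∀ {n k} → (Fin n → Fin n → Fin k) → Fin k → Fin n → Fin n → Set
Adj c a x y = (x ≢ y) × (c x y ≡ a)

Bipartite : ∀ {n k} → (Fin n → Fin n → Fin k) → Fin k → Set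
Bipartite {n} c a = Σ (Fin n → Bool) λ side → ∀ x y → Adj c a x y → side x ≢ side y

p4d : Fin 4 → Fin 4 → Bool
p4d zero (suc zero) = true
p4d (suc zero) (suc (suc zero)) = true
p4d (suc (suc zero)) (suc (suc (suc zero))) = true
p4d _ _ = false

c4d : Fin 4 → Fin 4 → Bool
c4d zero (suc zero) = true
c4d (suc zero) (suc (suc zero)) = true
c4d (suc (suc zero)) (suc (suc (suc zero))) = true
c4d (suc (suc (suc zero))) zero = true
c4d _ _ = false

s4d : Fin 4 → Fin 4 → Bool
s4d zero (suc zero) = true
s4d zero (suc (suc zero)) = true
s4d zero (suc (suc (suc zero))) = true
s4d _ _ = false

sym4 : (Fin 4 → Fin 4 → Bool) → Fin 4 → Fin 4 → Bool
sym4 h p q = h p q ∨ h q p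

P4 C4 S4 : Fin 4 → Fin 4 → Bool
P4 = sym4 p4d
C4 = sym4 c4d
S4 = sym4 s4d

InducedCopy : ∀ {n k} → (Fin 4 → Fin 4 → Bool) → (Fin n → Fin n → Fin k) → Fin k → Set
InducedCopy {n} H c a =
  Σ (Fin 4 → Fin n) λ f → Injective _≡_ _≡_ f ×
    (∀ p q → p ≢ q → (Adj c a (f p) (f q) → T (H p q)) × (T (H p q) → Adj c a (f p) (f q)))

Avoiding : ∀ {n k} → Colouring n k → Set
Avoiding {n} {k} (c , _) = ∀ (a : Fin k) →
  Bipartite c a × ¬ InducedCopy P4 c a × ¬ InducedCopy C4 c a × ¬ InducedCopy S4 c a

HasPartition : ℕ → ℕ → Set
HasPartition n k = Σ (Colouring n k) Avoiding

-- A bipartite graph has no induced P₄, C₄ or S₄ exactly when each of its components is a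
-- path with at most two edges.  Such a graph on n vertices has at most 2n/3 edges, so a
-- partition of K_n needs k ≥ 3(n − 1)/4 parts; the count is made explicit by an injection
-- that gives every ordered pair of adjacent vertices three tokens and every vertex four
-- slots per colour.
--
-- Conversely, K₉ is the union of six spanning graphs, each consisting of three paths with two
-- edges.  Blow every vertex p of K₉ up into a copy {p} × K_t: an edge (p , i) (q , j) with
-- p ≠ q gets the colour (class of pq , i + j mod t), and an edge inside a copy keeps its colour
-- in a partition of K_t.  This partitions K_{9t} into 6t + k parts, and iterating along
-- n ↦ ⌈n/9⌉ gives 4Mk ≤ (3M + 2)n + 448M² for every M ≥ 1.

module Submission where

open import Defs
open import Data.Bool using (Bool; true; false; T)
open import Data.Bool.Properties using (∨-comm; ¬-not)
open import Data.Empty using (⊥-elim)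
open import Data.Fin using (Fin; zero; toℕ; _≟_; inject₁; fromℕ; punchIn; combine; join; splitAt)
open import Data.Fin.Patterns using (0F; 1F; 2F; 3F; 4F; 5F; 6F; 7F; 8F)
open import Data.Fin.Properties
  using (<-cmp; <-asym; any?; all?; toℕ<n; toℕ-injective; toℕ-fromℕ<; inject≤-injective; inject₁-injective;
         fromℕ≢inject₁; combine-injective; splitAt-join; punchIn-injective; punchInᵢ≢i; injective⇒≤; *↔×; +↔⊎)
open import Data.Nat using (ℕ; zero; suc; _+_; _*_; _∸_; _≤_; _<_; z≤n; s≤s; s≤s⁻¹; _≤?_; NonZero; >-nonZero)
open import Data.Nat.DivMod using (_/_; _%_; _mod_; m≡m%n+[m/n]*n; m/n*n≤m; m%n<n)
open import Data.Nat.Divisibility using (_∣_; divides; >⇒∤)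
open import Data.Nat.Induction using (<-rec)
open import Data.Nat.Properties
  using (≤-refl; ≤-trans; ≤-antisym; ≤-<-trans; <⇒≱; ≰⇒>; +-comm; *-comm; *-assoc; *-suc; *-identityˡ;
         *-distribˡ-+; *-distribʳ-+; *-distribʳ-∸; [m+n]∸[m+o]≡n∸o; m∸n≤m; m∸n≡0⇒m≤n; m≤m+n; m≤n+m;
         m≤n*m; m≤m*n; +-monoˡ-≤; +-monoʳ-≤; +-monoʳ-<; *-monoˡ-≤; *-monoʳ-≤; *-monoʳ-<; *-mono-≤;
         +-cancelʳ-≤; *-cancelˡ-≤; *-cancelˡ-<; module ≤-Reasoning)
open import Data.Nat.Tactic.RingSolver using (solve-∀)
open import Data.Product using (_×_; _,_; proj₁; proj₂; ∃; swap)
open import Data.Product.Function.NonDependent.Propositional using (_×-↔_)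
open import Data.Product.Properties using (,-injective)
open import Data.Sum using (_⊎_; inj₁; inj₂; [_,_]′)
import Data.Sum as Sum
open import Data.Sum.Function.Propositional using (_⊎-↔_)
open import Data.Sum.Properties using (inj₁-injective; inj₂-injective)
open import Data.Unit using (tt)
open import Data.Vec using (Vec; _∷_; []; lookup)
open import Function using (id; _∘_; case_of_; Injection; Inverse; _↣_; _↔_; mk↣)
open import Function.Construct.Composition using (_↣-∘_)
open import Function.Definitions using (Injective)
open import Function.Properties.Inverse using (↔-refl; ↔-sym; ↔-trans; ↔⇒↣)
open import Relation.Binary.Definitions using (tri<; tri≈; tri>)
open import Relation.Binary.PropositionalEquality
open import Relation.Nullary using (¬_; Dec; yes; no; ¬?; contradiction)
open import Relation.Nullary.Decidable using (_×-dec_; _⊎-dec_; from-yes; decidable-stable)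
open import Relation.Nullary.Reflects using (Reflects; ofʸ; ofⁿ)

Edge : {V C : Set} → (V → V → C) → C → V → V → Set
Edge c a x y = x ≢ y × c x y ≡ a

-- The graphs whose components are paths with at most two edges.
record ShortPathForest {V : Set} (_~_ : V → V → Set) : Set where
  field
    side           : V → Bool
    side-flips     : ∀ {x y} → x ~ y → side x ≢ side y
    degree≤2       : ∀ {x y₁ y₂ y₃} → x ~ y₁ → x ~ y₂ → x ~ y₃ → y₁ ≡ y₂ ⊎ y₁ ≡ y₃ ⊎ y₂ ≡ y₃
    leaf-of-centre : ∀ {x y z w} → x ~ y → x ~ z → y ≢ z → y ~ w → w ≡ x

module _ {U V : Set} {_~_ : U → U → Set} {_≈_ : V → V → Set} where

  comap : (g : V → U) → Injective _≡_ _≡_ g → (∀ {x y} → x ≈ y → g x ~ g y) →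
          ShortPathForest _~_ → ShortPathForest _≈_
  comap g g-inj g-hom F = record
    { side           = side ∘ g
    ; side-flips     = side-flips ∘ g-hom
    ; degree≤2       = λ e₁ e₂ e₃ →
        Sum.map g-inj (Sum.map g-inj g-inj) (degree≤2 (g-hom e₁) (g-hom e₂) (g-hom e₃))
    ; leaf-of-centre = λ x~y x~z y≢z y~w →
        g-inj (leaf-of-centre (g-hom x~y) (g-hom x~z) (y≢z ∘ g-inj) (g-hom y~w))
    }
    where open ShortPathForest F

_⊗_ : {U V : Set} → (U → U → Set) → (V → V → Set) → U × V → U × V → Set
(_~_ ⊗ _≈_) x y = proj₁ x ~ proj₁ y × proj₂ x ≈ proj₂ y

Functional : {V : Set} → (V → V → Set) → Set
Functional _≈_ = ∀ {i j j′} → i ≈ j → i ≈ j′ → j ≡ j′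

module _ {U V : Set} {_~_ : U → U → Set} {_≈_ : V → V → Set}
         (≈-functional : Functional _≈_) (≈-sym : ∀ {i j} → i ≈ j → j ≈ i) where

  forest⊗matching : ShortPathForest _~_ → ShortPathForest (_~_ ⊗ _≈_)
  forest⊗matching F = record
    { side           = side ∘ proj₁
    ; side-flips     = side-flips ∘ proj₁
    ; degree≤2       = λ e₁ e₂ e₃ →
        Sum.map (partner e₁ e₂) (Sum.map (partner e₁ e₃) (partner e₂ e₃))
                (degree≤2 (proj₁ e₁) (proj₁ e₂) (proj₁ e₃))
    ; leaf-of-centre = λ x~y x~z y≢z y~w →
        cong₂ _,_ (leaf-of-centre (proj₁ x~y) (proj₁ x~z) (y≢z ∘ partner x~y x~z) (proj₁ y~w))
                  (≈-functional (proj₂ y~w) (≈-sym (proj₂ x~y)))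
    }
    where
    open ShortPathForest F
    partner : ∀ {x y y′} → (_~_ ⊗ _≈_) x y → (_~_ ⊗ _≈_) x y′ → proj₁ y ≡ proj₁ y′ → y ≡ y′
    partner (_ , i≈j) (_ , i≈j′) q≡q′ = cong₂ _,_ q≡q′ (≈-functional i≈j i≈j′)

  matching⊗forest : ShortPathForest _~_ → ShortPathForest (_≈_ ⊗ _~_)
  matching⊗forest F = comap swap (cong swap) swap (forest⊗matching F)

edgeless-forest : ∀ {V : Set} {_~_ : V → V → Set} → (∀ {x y} → ¬ x ~ y) → ShortPathForest _~_
edgeless-forest no-edge = record
  { side           = λ _ → true
  ; side-flips     = ⊥-elim ∘ no-edge
  ; degree≤2       = ⊥-elim ∘ no-edge
  ; leaf-of-centre = λ x~y _ _ _ → ⊥-elim (no-edge x~y)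
  }

AvoidingClass : ∀ {n k} → (Fin n → Fin n → Fin k) → Fin k → Set
AvoidingClass c a =
  Bipartite c a × ¬ InducedCopy P4 c a × ¬ InducedCopy C4 c a × ¬ InducedCopy S4 c a

module _ {n k} {c : Fin n → Fin n → Fin k} {a : Fin k} where

  noInducedCopy-⊇P4 : ∀ {H : Fin 4 → Fin 4 → Bool} → T (H 1F 0F) → T (H 1F 2F) → T (H 2F 3F) →
                      ShortPathForest (Adj c a) → ¬ InducedCopy H c a
  noInducedCopy-⊇P4 {H} h₁₀ h₁₂ h₂₃ F (f , f-inj , f-H) =
    distinct (λ ()) (leaf-of-centre (edge 1F 2F (λ ()) h₁₂) (edge 1F 0F (λ ()) h₁₀) (distinct (λ ()))
                                    (edge 2F 3F (λ ()) h₂₃))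
    where
    open ShortPathForest F
    edge : ∀ p q → p ≢ q → T (H p q) → Adj c a (f p) (f q)
    edge p q p≢q = proj₂ (f-H p q p≢q)
    distinct : ∀ {p q} → p ≢ q → f p ≢ f q
    distinct p≢q = p≢q ∘ f-inj

  noInducedCopy-S4 : ShortPathForest (Adj c a) → ¬ InducedCopy S4 c a
  noInducedCopy-S4 F (f , f-inj , f-H) =
    [ distinct (λ ()) , [ distinct (λ ()) , distinct (λ ()) ]′ ]′
      (degree≤2 (edge 1F (λ ()) tt) (edge 2F (λ ()) tt) (edge 3F (λ ()) tt))
    where
    open ShortPathForest F
    edge : ∀ q → 0F ≢ q → T (S4 0F q) → Adj c a (f 0F) (f q)
    edge q 0≢q = proj₂ (f-H 0F q 0≢q)
    distinct : ∀ {p q} → p ≢ q → f p ≢ f q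
    distinct p≢q = p≢q ∘ f-inj

  forest⇒avoiding : ShortPathForest (Adj c a) → AvoidingClass c a
  forest⇒avoiding F =
    (side , λ _ _ → side-flips) ,
    noInducedCopy-⊇P4 tt tt tt F , noInducedCopy-⊇P4 tt tt tt F , noInducedCopy-S4 F
    where open ShortPathForest F

from-upper-pairs : {P : Fin 4 → Fin 4 → Set} → (∀ {p q} → P p q → P q p) →
  P 0F 1F → P 0F 2F → P 0F 3F → P 1F 2F → P 1F 3F → P 2F 3F → ∀ p q → p ≢ q → P p q
from-upper-pairs {P} flip p₀₁ p₀₂ p₀₃ p₁₂ p₁₃ p₂₃ = go
  where
  go : ∀ p q → p ≢ q → P p q
  go 0F 1F _ = p₀₁
  go 0F 2F _ = p₀₂
  go 0F 3F _ = p₀₃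
  go 1F 2F _ = p₁₂
  go 1F 3F _ = p₁₃
  go 2F 3F _ = p₂₃
  go 1F 0F _ = flip p₀₁
  go 2F 0F _ = flip p₀₂
  go 3F 0F _ = flip p₀₃
  go 2F 1F _ = flip p₁₂
  go 3F 1F _ = flip p₁₃
  go 3F 2F _ = flip p₂₃
  go 0F 0F p≢p = ⊥-elim (p≢p refl)
  go 1F 1F p≢p = ⊥-elim (p≢p refl)
  go 2F 2F p≢p = ⊥-elim (p≢p refl)
  go 3F 3F p≢p = ⊥-elim (p≢p refl)

reflects⇒T⇔ : ∀ {A : Set} {b} → Reflects A b → (A → T b) × (T b → A)
reflects⇒T⇔ (ofʸ a)  = (λ _ → tt) , (λ _ → a)
reflects⇒T⇔ (ofⁿ ¬a) = (λ a → ⊥-elim (¬a a)) , (λ ())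

sym4-sym : ∀ h p q → sym4 h p q ≡ sym4 h q p
sym4-sym h p q = ∨-comm (h p q) (h q p)

module _ {n k} {c : Fin n → Fin n → Fin k} (c-sym : ∀ x y → c x y ≡ c y x) {a : Fin k} where

  Adj-sym : ∀ {x y} → Adj c a x y → Adj c a y x
  Adj-sym (x≢y , cxy≡a) = x≢y ∘ sym , trans (c-sym _ _) cxy≡a

  Faithful : (Fin 4 → Fin 4 → Bool) → (Fin 4 → Fin n) → Fin 4 → Fin 4 → Set
  Faithful H v p q = v p ≢ v q × Reflects (Adj c a (v p) (v q)) (H p q)

  inducedCopy : ∀ H → (∀ p q → H p q ≡ H q p) → (v : Fin 4 → Fin n) →
    Faithful H v 0F 1F → Faithful H v 0F 2F → Faithful H v 0F 3F →
    Faithful H v 1F 2F → Faithful H v 1F 3F → Faithful H v 2F 3F → InducedCopy H c a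
  inducedCopy H H-sym v f₀₁ f₀₂ f₀₃ f₁₂ f₁₃ f₂₃ =
    v , v-inj , λ p q p≢q → reflects⇒T⇔ (proj₂ (faithful p q p≢q))
    where
    flip : ∀ {p q} → Faithful H v p q → Faithful H v q p
    flip {p} {q} (vp≢vq , r) = vp≢vq ∘ sym , subst (Reflects _) (H-sym p q) (reflects-sym r)
      where
      reflects-sym : ∀ {b} → Reflects (Adj c a (v p) (v q)) b → Reflects (Adj c a (v q) (v p)) b
      reflects-sym (ofʸ e)  = ofʸ (Adj-sym e)
      reflects-sym (ofⁿ ¬e) = ofⁿ (¬e ∘ Adj-sym)
    faithful : ∀ p q → p ≢ q → Faithful H v p q
    faithful = from-upper-pairs flip f₀₁ f₀₂ f₀₃ f₁₂ f₁₃ f₂₃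
    v-inj : Injective _≡_ _≡_ v
    v-inj {p} {q} vp≡vq with p ≟ q
    ... | yes p≡q = p≡q
    ... | no p≢q  = ⊥-elim (proj₁ (faithful p q p≢q) vp≡vq)

  neighbours-non-adjacent : Bipartite c a → ∀ {x y z} → Adj c a x y → Adj c a x z → ¬ Adj c a y z
  neighbours-non-adjacent (side , flips) x~y x~z y~z =
    flips _ _ y~z (trans (¬-not (flips _ _ x~y ∘ sym)) (sym (¬-not (flips _ _ x~z ∘ sym))))

  inducedS4 : Bipartite c a → ∀ {x y₁ y₂ y₃} → Adj c a x y₁ → Adj c a x y₂ → Adj c a x y₃ →
              y₁ ≢ y₂ → y₁ ≢ y₃ → y₂ ≢ y₃ → InducedCopy S4 c a
  inducedS4 bip {x} {y₁} {y₂} {y₃} e₁ e₂ e₃ y₁≢y₂ y₁≢y₃ y₂≢y₃ =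
    inducedCopy S4 (sym4-sym s4d) (lookup (x ∷ y₁ ∷ y₂ ∷ y₃ ∷ []))
      (proj₁ e₁ , ofʸ e₁) (proj₁ e₂ , ofʸ e₂) (proj₁ e₃ , ofʸ e₃)
      (y₁≢y₂ , ofⁿ (neighbours-non-adjacent bip e₁ e₂))
      (y₁≢y₃ , ofⁿ (neighbours-non-adjacent bip e₁ e₃))
      (y₂≢y₃ , ofⁿ (neighbours-non-adjacent bip e₂ e₃))

  -- w — y — x — z is an induced P4, or an induced C4 when w is adjacent to z.
  inducedP4orC4 : Bipartite c a → ∀ {x y z w} → Adj c a x y → Adj c a x z → y ≢ z → Adj c a y w → w ≢ x →
                  InducedCopy P4 c a ⊎ InducedCopy C4 c a
  inducedP4orC4 bip {x} {y} {z} {w} x~y x~z y≢z y~w w≢x = case c w z ≟ a of λ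
    { (yes cwz≡a) → inj₂ (inducedCopy C4 (sym4-sym c4d) v f₀₁ f₀₂ (w≢z , ofʸ (w≢z , cwz≡a)) f₁₂ f₁₃ f₂₃)
    ; (no cwz≢a)  → inj₁ (inducedCopy P4 (sym4-sym p4d) v f₀₁ f₀₂ (w≢z , ofⁿ (cwz≢a ∘ proj₂)) f₁₂ f₁₃ f₂₃)
    }
    where
    v : Fin 4 → Fin n
    v = lookup (w ∷ y ∷ x ∷ z ∷ [])
    y~x : Adj c a y x
    y~x = Adj-sym x~y
    w≢z : w ≢ z
    w≢z refl = neighbours-non-adjacent bip x~y x~z y~w
    f₀₁ : w ≢ y × Reflects (Adj c a w y) true
    f₀₁ = proj₁ (Adj-sym y~w) , ofʸ (Adj-sym y~w)
    f₀₂ : w ≢ x × Reflects (Adj c a w x) false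
    f₀₂ = w≢x , ofⁿ (neighbours-non-adjacent bip y~w y~x)
    f₁₂ : y ≢ x × Reflects (Adj c a y x) true
    f₁₂ = proj₁ y~x , ofʸ y~x
    f₁₃ : y ≢ z × Reflects (Adj c a y z) false
    f₁₃ = y≢z , ofⁿ (neighbours-non-adjacent bip x~y x~z)
    f₂₃ : x ≢ z × Reflects (Adj c a x z) true
    f₂₃ = proj₁ x~z , ofʸ x~z

  avoiding⇒forest : AvoidingClass c a → ShortPathForest (Adj c a)
  avoiding⇒forest (bip@(side , flips) , noP4 , noC4 , noS4) = record
    { side           = side
    ; side-flips     = flips _ _
    ; degree≤2       = degree≤2
    ; leaf-of-centre = λ {x} {w = w} x~y x~z y≢z y~w → decidable-stable (w ≟ x) λ w≢x →
        [ noP4 , noC4 ]′ (inducedP4orC4 bip x~y x~z y≢z y~w w≢x)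
    }
    where
    degree≤2 : ∀ {x y₁ y₂ y₃} → Adj c a x y₁ → Adj c a x y₂ → Adj c a x y₃ →
               y₁ ≡ y₂ ⊎ y₁ ≡ y₃ ⊎ y₂ ≡ y₃
    degree≤2 {x} {y₁} {y₂} {y₃} e₁ e₂ e₃ with y₁ ≟ y₂ | y₁ ≟ y₃ | y₂ ≟ y₃
    ... | yes y₁≡y₂ | _         | _         = inj₁ y₁≡y₂
    ... | no _      | yes y₁≡y₃ | _         = inj₂ (inj₁ y₁≡y₃)
    ... | no _      | no _      | yes y₂≡y₃ = inj₂ (inj₂ y₂≡y₃)
    ... | no y₁≢y₂  | no y₁≢y₃  | no y₂≢y₃  = ⊥-elim (noS4 (inducedS4 bip e₁ e₂ e₃ y₁≢y₂ y₁≢y₃ y₂≢y₃))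

partitionFrom : ∀ {V C : Set} {n k} (c : V → V → C) → (∀ x y → c x y ≡ c y x) →
  (∀ a → ShortPathForest (Edge c a)) → Fin n ↣ V → C ↔ Fin k → HasPartition n k
partitionFrom {n = n} {k} c c-sym forests ι κ = (c′ , c′-sym) , λ a →
  forest⇒avoiding (comap (Injection.to ι) (Injection.injective ι) edge (forests (Inverse.from κ a)))
  where
  c′ : Fin n → Fin n → Fin k
  c′ x y = Inverse.to κ (c (Injection.to ι x) (Injection.to ι y))
  c′-sym : ∀ x y → c′ x y ≡ c′ y x
  c′-sym x y = cong (Inverse.to κ) (c-sym _ _)
  edge : ∀ {a x y} → Adj c′ a x y → Edge c (Inverse.from κ a) (Injection.to ι x) (Injection.to ι y)
  edge (x≢y , c′xy≡a) = x≢y ∘ Injection.injective ι ,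
    trans (sym (Inverse.strictlyInverseʳ κ _)) (cong (Inverse.from κ) c′xy≡a)

restrict : ∀ {n n′ k} → n ≤ n′ → HasPartition n′ k → HasPartition n k
restrict n≤n′ ((c , c-sym) , avoiding) =
  partitionFrom c c-sym (λ a → avoiding⇒forest c-sym (avoiding a))
    (mk↣ (inject≤-injective n≤n′ n≤n′ _ _)) ↔-refl

rank : ∀ {n} → Fin n → Fin n → Fin 2
rank y z with <-cmp y z
... | tri< _ _ _ = 0F
... | tri≈ _ _ _ = 1F
... | tri> _ _ _ = 1F

rank-anti : ∀ {n} {y z : Fin n} → y ≢ z → rank y z ≢ rank z y
rank-anti {y = y} {z} y≢z with <-cmp y z | <-cmp z y
... | tri< y<z _ _ | tri< z<y _ _ = λ _ → <-asym y<z z<y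
... | tri< _ _ _   | tri≈ _ z≡y _ = λ _ → y≢z (sym z≡y)
... | tri< _ _ _   | tri> _ _ _   = λ ()
... | tri≈ _ y≡z _ | _            = λ _ → y≢z y≡z
... | tri> _ _ _   | tri< _ _ _   = λ ()
... | tri> _ _ _   | tri≈ _ z≡y _ = λ _ → y≢z (sym z≡y)
... | tri> _ _ z<y | tri> _ _ y<z = λ _ → <-asym y<z z<y

module Tokens {n} {_~_ : Fin n → Fin n → Set} (_~?_ : ∀ x y → Dec (x ~ y))
              (~-sym : ∀ {x y} → x ~ y → y ~ x) (F : ShortPathForest _~_) where

  open ShortPathForest F

  OtherNeighbour : Fin n → Fin n → Set
  OtherNeighbour x y = ∃ λ z → z ≢ y × x ~ z

  otherNeighbour? : ∀ x y → Dec (OtherNeighbour x y)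
  otherNeighbour? x y = any? λ z → ¬? (z ≟ y) ×-dec (x ~? z)

  -- Every edge x ~ y sends three tokens from x into the four slots of some vertex.  A leaf x
  -- keeps all three in its slots 0–2; a centre x keeps two in the pair of slots chosen by the
  -- rank of y among its two neighbours, and sends the third to the free slot 3 of the leaf y.
  token : ∀ x y → Dec (OtherNeighbour x y) → Fin 2 ⊎ Fin 1 → Fin n × Fin 4
  token x y (no _)        t        = x , inject₁ (join 2 1 t)
  token x y (yes (z , _)) (inj₁ j) = x , combine (rank y z) j
  token x y (yes _)       (inj₂ _) = y , fromℕ 3

  only-neighbour : ∀ {x y y′} → ¬ OtherNeighbour x y → x ~ y′ → y′ ≡ y
  only-neighbour {y = y} {y′} ¬other x~y′ =
    decidable-stable (y′ ≟ y) (λ y′≢y → ¬other (y′ , y′≢y , x~y′))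

  other-neighbour-unique : ∀ {x y z w} → x ~ y → x ~ z → z ≢ y → x ~ w → w ≢ y → w ≡ z
  other-neighbour-unique x~y x~z z≢y x~w w≢y with degree≤2 x~y x~z x~w
  ... | inj₁ y≡z        = ⊥-elim (z≢y (sym y≡z))
  ... | inj₂ (inj₁ y≡w) = ⊥-elim (w≢y (sym y≡w))
  ... | inj₂ (inj₂ z≡w) = sym z≡w

  rank-determines-neighbour : ∀ {x y z y′ z′} → x ~ y → x ~ z → z ≢ y → x ~ y′ → x ~ z′ → z′ ≢ y′ →
                              rank y z ≡ rank y′ z′ → y ≡ y′
  rank-determines-neighbour {y = y} {z} {y′} {z′} x~y x~z z≢y x~y′ x~z′ z′≢y′ ranks≡ =
    decidable-stable (y ≟ y′) λ y≢y′ → rank-anti y≢y′ (begin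
      rank y y′    ≡⟨ cong (rank y) (other-neighbour-unique x~y x~z z≢y x~y′ (y≢y′ ∘ sym)) ⟩
      rank y z     ≡⟨ ranks≡ ⟩
      rank y′ z′   ≡⟨ cong (rank y′) (other-neighbour-unique x~y′ x~z′ z′≢y′ x~y y≢y′) ⟨
      rank y′ y    ∎)
    where open ≡-Reasoning

  leaf≢centre-token : ∀ {x y x′ y′ t t′} (¬o : ¬ OtherNeighbour x y) → x′ ~ y′ →
                      (o′ : OtherNeighbour x′ y′) → token x y (no ¬o) t ≢ token x′ y′ (yes o′) t′
  leaf≢centre-token {t′ = inj₁ _} ¬o x′~y′ (z′ , z′≢y′ , x′~z′) eq with cong proj₁ eq
  ... | refl = z′≢y′ (trans (only-neighbour ¬o x′~z′) (sym (only-neighbour ¬o x′~y′)))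
  leaf≢centre-token {t′ = inj₂ _} _ _ _ eq = fromℕ≢inject₁ (sym (cong proj₂ eq))

  sent≢kept-token : ∀ {x y x′ y′ u j′} → x ~ y → (o : OtherNeighbour x y) → x′ ~ y′ →
                    (o′ : OtherNeighbour x′ y′) → token x y (yes o) (inj₂ u) ≢ token x′ y′ (yes o′) (inj₁ j′)
  sent≢kept-token x~y (z , z≢y , x~z) y~y′ (z′ , z′≢y′ , y~z′) eq with cong proj₁ eq
  ... | refl = z′≢y′ (trans (leaf-of-centre x~y x~z (z≢y ∘ sym) y~z′)
                            (sym (leaf-of-centre x~y x~z (z≢y ∘ sym) y~y′)))

  token-injective : ∀ {x y x′ y′ t t′} → x ~ y → x′ ~ y′ →
                    (d : Dec (OtherNeighbour x y)) (d′ : Dec (OtherNeighbour x′ y′)) →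
                    token x y d t ≡ token x′ y′ d′ t′ → x ≡ x′ × y ≡ y′ × t ≡ t′
  token-injective {t = t} {t′} x~y x′~y′ (no ¬o) (no ¬o′) eq with cong proj₁ eq
  ... | refl =
    refl , sym (only-neighbour ¬o x′~y′) , join-injective {t} {t′} (inject₁-injective (cong proj₂ eq))
    where
    join-injective : ∀ {t t′} → join 2 1 t ≡ join 2 1 t′ → t ≡ t′
    join-injective {t} {t′} e =
      trans (sym (splitAt-join 2 1 t)) (trans (cong (splitAt 2) e) (splitAt-join 2 1 t′))
  token-injective {t = t} {t′} x~y x′~y′ (no ¬o) (yes o′) eq =
    ⊥-elim (leaf≢centre-token {t = t} {t′} ¬o x′~y′ o′ eq)
  token-injective {t = t} {t′} x~y x′~y′ (yes o) (no ¬o′) eq =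
    ⊥-elim (leaf≢centre-token {t = t′} {t} ¬o′ x~y o (sym eq))
  token-injective {t = inj₁ j} {inj₁ j′} x~y x′~y′ (yes (z , z≢y , x~z)) (yes (z′ , z′≢y′ , x′~z′)) eq
    with cong proj₁ eq | combine-injective (rank _ z) j (rank _ z′) j′ (cong proj₂ eq)
  ... | refl | ranks≡ , refl =
    refl , rank-determines-neighbour x~y x~z z≢y x′~y′ x′~z′ z′≢y′ ranks≡ , refl
  token-injective {t = inj₂ 0F} {inj₂ 0F} x~y x′~y′ (yes (z , z≢y , x~z)) (yes _) eq with cong proj₁ eq
  ... | refl = sym (leaf-of-centre x~y x~z (z≢y ∘ sym) (~-sym x′~y′)) , refl , refl
  token-injective {t = inj₂ u} {inj₁ j′} x~y x′~y′ (yes o) (yes o′) eq =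
    ⊥-elim (sent≢kept-token {u = u} {j′} x~y o x′~y′ o′ eq)
  token-injective {t = inj₁ j} {inj₂ u′} x~y x′~y′ (yes o) (yes o′) eq =
    ⊥-elim (sent≢kept-token {u = u′} {j} x′~y′ o′ x~y o (sym eq))

module _ {n k} {c : Fin (suc n) → Fin (suc n) → Fin k} (c-sym : ∀ x y → c x y ≡ c y x)
         (avoiding : ∀ a → AvoidingClass c a) where

  private
    adj? : ∀ a x y → Dec (Adj c a x y)
    adj? a x y = ¬? (x ≟ y) ×-dec (c x y ≟ a)

    module T (a : Fin k) = Tokens (adj? a) (Adj-sym c-sym) (avoiding⇒forest c-sym (avoiding a))

  colouredToken : Fin k → Fin (suc n) → Fin (suc n) → Fin 2 ⊎ Fin 1 → Fin (suc n) × Fin k × Fin 4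
  colouredToken a x y t = let (v , s) = T.token a x y (T.otherNeighbour? a x y) t in v , a , s

  colouredToken-injective : ∀ {a a′ x y x′ y′ t t′} → Adj c a x y → Adj c a′ x′ y′ →
    colouredToken a x y t ≡ colouredToken a′ x′ y′ t′ → x ≡ x′ × y ≡ y′ × t ≡ t′
  colouredToken-injective {a} {x = x} {y} {x′} {y′} x~y x′~y′ eq with cong (proj₁ ∘ proj₂) eq
  ... | refl = T.token-injective a x~y x′~y′ (T.otherNeighbour? a x y) (T.otherNeighbour? a x′ y′)
                 (cong (λ (v , _ , s) → v , s) eq)

  tokenOf : Fin (suc n) × Fin n × (Fin 2 ⊎ Fin 1) → Fin (suc n) × Fin k × Fin 4
  tokenOf (x , j , t) = colouredToken (c x (punchIn x j)) x (punchIn x j) t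

  tokenOf-injective : Injective _≡_ _≡_ tokenOf
  tokenOf-injective {x , j , t} {x′ , j′ , t′} eq with colouredToken-injective (edge x j) (edge x′ j′) eq
    where
    edge : ∀ x j → Adj c (c x (punchIn x j)) x (punchIn x j)
    edge x j = punchInᵢ≢i x j ∘ sym , refl
  ... | refl , y≡y′ , refl = cong (λ j → x , j , t) (punchIn-injective x j j′ y≡y′)

↣⇒≤ : ∀ {m n} → Fin m ↣ Fin n → m ≤ n
↣⇒≤ f = injective⇒≤ (Injection.injective f)

lower-bound : ∀ {n k} → HasPartition n k → 3 * n ≤ 4 * k + 3
lower-bound {zero}      _                          = z≤n
lower-bound {suc n} {k} ((c , c-sym) , avoiding) = begin
  3 * suc n   ≡⟨ *-suc 3 n ⟩
  3 + 3 * n   ≡⟨ +-comm 3 (3 * n) ⟩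
  3 * n + 3   ≤⟨ +-monoˡ-≤ 3 (subst₂ _≤_ (*-comm n 3) (*-comm k 4) (*-cancelˡ-≤ (suc n) counted)) ⟩
  4 * k + 3   ∎
  where
  open ≤-Reasoning
  counted : suc n * (n * 3) ≤ suc n * (k * 4)
  counted = ↣⇒≤ (↔⇒↣ slots ↣-∘ (mk↣ (tokenOf-injective c-sym avoiding) ↣-∘ ↔⇒↣ tokens))
    where
    tokens : Fin (suc n * (n * 3)) ↔ (Fin (suc n) × Fin n × (Fin 2 ⊎ Fin 1))
    tokens = ↔-trans *↔× (↔-refl ×-↔ (↔-trans *↔× (↔-refl ×-↔ +↔⊎)))
    slots : (Fin (suc n) × Fin k × Fin 4) ↔ Fin (suc n * (k * 4))
    slots = ↔-sym (↔-trans *↔× (↔-refl ×-↔ *↔×))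

%-≡⇒∣∸ : ∀ m n t .{{_ : NonZero t}} → m % t ≡ n % t → t ∣ m ∸ n
%-≡⇒∣∸ m n t m%t≡n%t = divides (m / t ∸ n / t) (begin
  m ∸ n                                       ≡⟨ cong₂ _∸_ (m≡m%n+[m/n]*n m t) (m≡m%n+[m/n]*n n t) ⟩
  (m % t + m / t * t) ∸ (n % t + n / t * t)   ≡⟨ cong (λ r → (m % t + m / t * t) ∸ (r + n / t * t)) (sym m%t≡n%t) ⟩
  (m % t + m / t * t) ∸ (m % t + n / t * t)   ≡⟨ [m+n]∸[m+o]≡n∸o (m % t) _ _ ⟩
  m / t * t ∸ n / t * t                       ≡⟨ *-distribʳ-∸ t (m / t) (n / t) ⟨
  (m / t ∸ n / t) * t                         ∎)
  where open ≡-Reasoning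

∣∧<⇒≡0 : ∀ {t d} .{{_ : NonZero t}} → t ∣ d → d < t → d ≡ 0
∣∧<⇒≡0 {d = zero}  _   _   = refl
∣∧<⇒≡0 {d = suc _} t∣d d<t = ⊥-elim (>⇒∤ d<t t∣d)

+-cancelˡ-% : ∀ a {b b′} t .{{_ : NonZero t}} → b < t → b′ < t → (a + b) % t ≡ (a + b′) % t → b ≡ b′
+-cancelˡ-% a {b} {b′} t b<t b′<t eq =
  ≤-antisym (m∸n≡0⇒m≤n (difference-vanishes b<t eq)) (m∸n≡0⇒m≤n (difference-vanishes b′<t (sym eq)))
  where
  difference-vanishes : ∀ {c c′} → c < t → (a + c) % t ≡ (a + c′) % t → c ∸ c′ ≡ 0
  difference-vanishes {c} {c′} c<t eq′ =
    ∣∧<⇒≡0 (subst (t ∣_) ([m+n]∸[m+o]≡n∸o a c c′) (%-≡⇒∣∸ _ _ t eq′)) (≤-<-trans (m∸n≤m c c′) c<t)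

module _ {t} .{{_ : NonZero t}} where

  infixl 6 _⊕_
  _⊕_ : Fin t → Fin t → Fin t
  i ⊕ j = (toℕ i + toℕ j) mod t

  ⊕-comm : ∀ i j → i ⊕ j ≡ j ⊕ i
  ⊕-comm i j = cong (_mod t) (+-comm (toℕ i) (toℕ j))

  ⊕-cancelˡ : ∀ i {j j′} → i ⊕ j ≡ i ⊕ j′ → j ≡ j′
  ⊕-cancelˡ i {j} {j′} eq = toℕ-injective (+-cancelˡ-% (toℕ i) t (toℕ<n j) (toℕ<n j′) (begin
    (toℕ i + toℕ j) % t    ≡⟨ toℕ-fromℕ< _ ⟨
    toℕ (i ⊕ j)            ≡⟨ cong toℕ eq ⟩
    toℕ (i ⊕ j′)           ≡⟨ toℕ-fromℕ< _ ⟩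
    (toℕ i + toℕ j′) % t   ∎))
    where open ≡-Reasoning

data PathEdge : Fin 3 → Fin 3 → Set where
  0—1 : PathEdge 0F 1F
  0—2 : PathEdge 0F 2F
  1—0 : PathEdge 1F 0F
  2—0 : PathEdge 2F 0F

pathEdge? : ∀ i j → Dec (PathEdge i j)
pathEdge? 0F 1F = yes 0—1
pathEdge? 0F 2F = yes 0—2
pathEdge? 1F 0F = yes 1—0
pathEdge? 2F 0F = yes 2—0
pathEdge? 0F 0F = no λ ()
pathEdge? 1F 1F = no λ ()
pathEdge? 1F 2F = no λ ()
pathEdge? 2F 1F = no λ ()
pathEdge? 2F 2F = no λ ()

path-forest : ShortPathForest PathEdge
path-forest = record
  { side           = isCentre
  ; side-flips     = side-flips
  ; degree≤2       = degree≤2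
  ; leaf-of-centre = leaf-of-centre
  }
  where
  isCentre : Fin 3 → Bool
  isCentre 0F = true
  isCentre _  = false
  side-flips : ∀ {x y} → PathEdge x y → isCentre x ≢ isCentre y
  side-flips 0—1 ()
  side-flips 0—2 ()
  side-flips 1—0 ()
  side-flips 2—0 ()
  degree≤2 : ∀ {x y₁ y₂ y₃} → PathEdge x y₁ → PathEdge x y₂ → PathEdge x y₃ → y₁ ≡ y₂ ⊎ y₁ ≡ y₃ ⊎ y₂ ≡ y₃
  degree≤2 0—1 0—1 _   = inj₁ refl
  degree≤2 0—2 0—2 _   = inj₁ refl
  degree≤2 0—1 0—2 0—1 = inj₂ (inj₁ refl)
  degree≤2 0—1 0—2 0—2 = inj₂ (inj₂ refl)
  degree≤2 0—2 0—1 0—1 = inj₂ (inj₂ refl)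
  degree≤2 0—2 0—1 0—2 = inj₂ (inj₁ refl)
  degree≤2 1—0 1—0 _   = inj₁ refl
  degree≤2 2—0 2—0 _   = inj₁ refl
  leaf-of-centre : ∀ {x y z w} → PathEdge x y → PathEdge x z → y ≢ z → PathEdge y w → w ≡ x
  leaf-of-centre 0—1 _   _   1—0 = refl
  leaf-of-centre 0—2 _   _   2—0 = refl
  leaf-of-centre 1—0 1—0 y≢z _   = ⊥-elim (y≢z refl)
  leaf-of-centre 2—0 2—0 y≢z _   = ⊥-elim (y≢z refl)

-- Row r lists the three paths of colour class r of a partition of K₉ into six
-- spanning forests of paths with two edges, each path as centre, leaf, leaf.
paths : Vec (Vec (Vec (Fin 9) 3) 3) 6
paths =
  ((0F ∷ 1F ∷ 5F ∷ []) ∷ (3F ∷ 4F ∷ 8F ∷ []) ∷ (6F ∷ 7F ∷ 2F ∷ []) ∷ []) ∷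
  ((1F ∷ 2F ∷ 3F ∷ []) ∷ (4F ∷ 5F ∷ 6F ∷ []) ∷ (7F ∷ 8F ∷ 0F ∷ []) ∷ []) ∷
  ((2F ∷ 0F ∷ 4F ∷ []) ∷ (5F ∷ 3F ∷ 7F ∷ []) ∷ (8F ∷ 6F ∷ 1F ∷ []) ∷ []) ∷
  ((0F ∷ 3F ∷ 8F ∷ []) ∷ (1F ∷ 4F ∷ 6F ∷ []) ∷ (2F ∷ 5F ∷ 7F ∷ []) ∷ []) ∷
  ((3F ∷ 6F ∷ 2F ∷ []) ∷ (4F ∷ 7F ∷ 0F ∷ []) ∷ (5F ∷ 8F ∷ 1F ∷ []) ∷ []) ∷
  ((6F ∷ 0F ∷ 5F ∷ []) ∷ (7F ∷ 1F ∷ 3F ∷ []) ∷ (8F ∷ 2F ∷ 4F ∷ []) ∷ []) ∷ []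

vertexAt : Fin 6 → Fin 3 × Fin 3 → Fin 9
vertexAt r (a , i) = lookup (lookup (lookup paths r) a) i

locate : Fin 6 → Fin 9 → Fin 3 × Fin 3
locate r p with any? (λ a → any? λ i → vertexAt r (a , i) ≟ p)
... | yes (a , i , _) = a , i
... | no _            = 0F , 0F

vertexAt-locate : ∀ r p → vertexAt r (locate r p) ≡ p
vertexAt-locate = from-yes (all? λ r → all? λ p → vertexAt r (locate r p) ≟ p)

locate-injective : ∀ r → Injective _≡_ _≡_ (locate r)
locate-injective r {p} {q} eq =
  trans (sym (vertexAt-locate r p)) (trans (cong (vertexAt r) eq) (vertexAt-locate r q))

InClass : Fin 6 → Fin 9 → Fin 9 → Set
InClass r p q = (_≡_ ⊗ PathEdge) (locate r p) (locate r q)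

inClass? : ∀ r p q → Dec (InClass r p q)
inClass? r p q = (proj₁ (locate r p) ≟ proj₁ (locate r q)) ×-dec pathEdge? _ _

classFrom : ∀ {p q} → Dec (∃ λ r → InClass r p q) → Fin 6
classFrom (yes (r , _)) = r
classFrom (no _)        = 0F

-- Opaque, since normalising the search during type checking is prohibitively expensive.
opaque
  classOf : Fin 9 → Fin 9 → Fin 6
  classOf p q = classFrom (any? λ r → inClass? r p q)

every-edge-in-a-class : ∀ p q → p ≡ q ⊎ ∃ λ r → InClass r p q
every-edge-in-a-class = from-yes (all? λ p → all? λ q → (p ≟ q) ⊎-dec any? λ r → inClass? r p q)

no-edge-in-two-classes : ∀ p q r r′ → r ≡ r′ ⊎ ¬ InClass r p q ⊎ ¬ InClass r′ p q
no-edge-in-two-classes = from-yes (all? λ p → all? λ q → all? λ r → all? λ r′ →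
  (r ≟ r′) ⊎-dec (¬? (inClass? r p q) ⊎-dec ¬? (inClass? r′ p q)))

InClass-unique : ∀ {p q r r′} → InClass r p q → InClass r′ p q → r ≡ r′
InClass-unique {p} {q} {r} {r′} e e′ = [ id , [ contradiction e , contradiction e′ ]′ ]′
  (no-edge-in-two-classes p q r r′)

InClass-sym : ∀ {r p q} → InClass r p q → InClass r q p
InClass-sym (a≡b , e) = sym a≡b , pathEdge-sym e
  where
  pathEdge-sym : ∀ {i j} → PathEdge i j → PathEdge j i
  pathEdge-sym 0—1 = 1—0
  pathEdge-sym 0—2 = 2—0
  pathEdge-sym 1—0 = 0—1
  pathEdge-sym 2—0 = 0—2

opaque
  unfolding classOf
  classOf-InClass : ∀ {p q} → p ≢ q → InClass (classOf p q) p q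
  classOf-InClass {p} {q} p≢q = from-class (any? λ r → inClass? r p q)
    where
    from-class : (d : Dec (∃ λ r → InClass r p q)) → InClass (classFrom d) p q
    from-class (yes (_ , in-class)) = in-class
    from-class (no no-class) = ⊥-elim ([ p≢q , no-class ]′ (every-edge-in-a-class p q))

classOf-sym : ∀ p q → classOf p q ≡ classOf q p
classOf-sym p q = by-cases (p ≟ q)
  where
  by-cases : Dec (p ≡ q) → classOf p q ≡ classOf q p
  by-cases (yes p≡q) = cong₂ classOf p≡q (sym p≡q)
  by-cases (no p≢q)  = InClass-unique {p} {q} {classOf p q} {classOf q p}
    (classOf-InClass p≢q) (InClass-sym {classOf q p} {q} {p} (classOf-InClass (p≢q ∘ sym)))

Edge⇒InClass : ∀ {r p q} → Edge classOf r p q → InClass r p q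
Edge⇒InClass {r} {p} {q} (p≢q , class≡r) = subst (λ r → InClass r p q) class≡r (classOf-InClass p≢q)

class-forest : ∀ r → ShortPathForest (Edge classOf r)
class-forest r = comap (locate r) (locate-injective r) Edge⇒InClass
  (matching⊗forest (λ i≡j i≡j′ → trans (sym i≡j) i≡j′) sym path-forest)

module _ {t k} .{{_ : NonZero t}} (d : Fin t → Fin t → Fin k) where

  blownUp : Fin 9 × Fin t → Fin 9 × Fin t → (Fin 6 × Fin t) ⊎ Fin k
  blownUp (p , i) (q , j) with p ≟ q
  ... | yes _ = inj₂ (d i j)
  ... | no _  = inj₁ (classOf p q , i ⊕ j)

  blownUp-sym : (∀ i j → d i j ≡ d j i) → ∀ x y → blownUp x y ≡ blownUp y x
  blownUp-sym d-sym (p , i) (q , j) with p ≟ q | q ≟ p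
  ... | yes _   | yes _   = cong inj₂ (d-sym i j)
  ... | yes p≡q | no q≢p  = ⊥-elim (q≢p (sym p≡q))
  ... | no p≢q  | yes q≡p = ⊥-elim (p≢q (sym q≡p))
  ... | no _    | no _    = cong inj₁ (cong₂ _,_ (classOf-sym p q) (⊕-comm i j))

  cross-edge : ∀ {r s x y} → Edge blownUp (inj₁ (r , s)) x y →
               (Edge classOf r ⊗ λ i j → i ⊕ j ≡ s) x y
  cross-edge {x = p , i} {q , j} (_ , colour≡) with p ≟ q
  ... | yes _  = ⊥-elim (inj₂≢inj₁ colour≡)
    where
    inj₂≢inj₁ : ∀ {u v} → inj₂ u ≢ inj₁ v
    inj₂≢inj₁ ()
  ... | no p≢q = let (r≡ , s≡) = ,-injective (inj₁-injective colour≡) in (p≢q , r≡) , s≡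

  block-edge : ∀ {b x y} → Edge blownUp (inj₂ b) x y → (_≡_ ⊗ Adj d b) x y
  block-edge {x = p , i} {q , j} (x≢y , colour≡) with p ≟ q
  ... | yes p≡q = p≡q , (λ i≡j → x≢y (cong₂ _,_ p≡q i≡j)) , inj₂-injective colour≡
  ... | no _    = ⊥-elim (inj₁≢inj₂ colour≡)
    where
    inj₁≢inj₂ : ∀ {u v} → inj₁ u ≢ inj₂ v
    inj₁≢inj₂ ()

  blownUp-forest : (∀ b → ShortPathForest (Adj d b)) → ∀ a → ShortPathForest (Edge blownUp a)
  blownUp-forest _ (inj₁ (r , s)) = comap id id cross-edge
    (forest⊗matching (λ e e′ → ⊕-cancelˡ _ (trans e (sym e′))) (λ {i} {j} e → trans (⊕-comm j i) e)
                     (class-forest r))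
  blownUp-forest d-forest (inj₂ b) = comap id id block-edge
    (matching⊗forest (λ e e′ → trans (sym e) e′) sym (d-forest b))

blowUp : ∀ {t k} .{{_ : NonZero t}} → HasPartition t k → HasPartition (9 * t) (6 * t + k)
blowUp {t} {k} ((d , d-sym) , avoiding) =
  partitionFrom (blownUp d) (blownUp-sym d d-sym)
    (blownUp-forest d (λ b → avoiding⇒forest d-sym (avoiding b)))
    (↔⇒↣ *↔×) (↔-trans (↔-sym *↔× ⊎-↔ ↔-refl) (↔-sym +↔⊎))

⌈_/9⌉ : ℕ → ℕ
⌈ n /9⌉ = (n + 8) / 9

n≤9*⌈n/9⌉ : ∀ n → n ≤ 9 * ⌈ n /9⌉
n≤9*⌈n/9⌉ n = +-cancelʳ-≤ 8 n (9 * ⌈ n /9⌉) (begin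
  n + 8                          ≡⟨ m≡m%n+[m/n]*n (n + 8) 9 ⟩
  (n + 8) % 9 + ⌈ n /9⌉ * 9      ≤⟨ +-monoˡ-≤ _ (s≤s⁻¹ (m%n<n (n + 8) 9)) ⟩
  8 + ⌈ n /9⌉ * 9                ≡⟨ +-comm 8 _ ⟩
  ⌈ n /9⌉ * 9 + 8                ≡⟨ cong (_+ 8) (*-comm ⌈ n /9⌉ 9) ⟩
  9 * ⌈ n /9⌉ + 8                ∎)
  where open ≤-Reasoning

9*⌈n/9⌉≤n+8 : ∀ n → 9 * ⌈ n /9⌉ ≤ n + 8
9*⌈n/9⌉≤n+8 n = subst (_≤ n + 8) (*-comm ⌈ n /9⌉ 9) (m/n*n≤m (n + 8) 9)

⌈n/9⌉<n : ∀ {n} → 2 ≤ n → ⌈ n /9⌉ < n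
⌈n/9⌉<n {n} 2≤n = *-cancelˡ-< 9 ⌈ n /9⌉ n (begin-strict
  9 * ⌈ n /9⌉   ≤⟨ 9*⌈n/9⌉≤n+8 n ⟩
  n + 8         <⟨ +-monoʳ-< n (*-monoʳ-< 8 2≤n) ⟩
  n + 8 * n     ≡⟨⟩
  9 * n         ∎)
  where open ≤-Reasoning

⌈n/9⌉-positive : ∀ {n} → 1 ≤ n → 1 ≤ ⌈ n /9⌉
⌈n/9⌉-positive {n} 1≤n with ⌈ n /9⌉ | n≤9*⌈n/9⌉ n
... | zero  | n≤0 = ⊥-elim (<⇒≱ 1≤n n≤0)
... | suc _ | _   = s≤s z≤n

grow : ∀ {n k} → 1 ≤ n → HasPartition ⌈ n /9⌉ k → HasPartition n (6 * ⌈ n /9⌉ + k)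
grow {n} 1≤n P = restrict (n≤9*⌈n/9⌉ n) (blowUp {{>-nonZero (⌈n/9⌉-positive 1≤n)}} P)

PartitionWithin : ℕ → ℕ → ℕ → ℕ → Set
PartitionWithin a b e n = ∃ λ k → HasPartition n k × a * k ≤ b * n + e

grow-within : ∀ {a b e n} → 1 ≤ n → (6 * a + b) * (n + 8) ≤ 9 * (b * n) →
              PartitionWithin a b e ⌈ n /9⌉ → PartitionWithin a b e n
grow-within {a} {b} {e} {n} 1≤n slack (k , P , ak≤) = 6 * t + k , grow 1≤n P , *-cancelˡ-≤ 9 (begin
  9 * (a * (6 * t + k))              ≡⟨ expand a t k ⟩
  6 * a * (9 * t) + 9 * (a * k)      ≤⟨ +-monoʳ-≤ (6 * a * (9 * t)) (*-monoʳ-≤ 9 ak≤) ⟩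
  6 * a * (9 * t) + 9 * (b * t + e)  ≡⟨ regroup a b t e ⟩
  (6 * a + b) * (9 * t) + 9 * e      ≤⟨ +-monoˡ-≤ (9 * e) (*-monoʳ-≤ (6 * a + b) (9*⌈n/9⌉≤n+8 n)) ⟩
  (6 * a + b) * (n + 8) + 9 * e      ≤⟨ +-monoˡ-≤ (9 * e) slack ⟩
  9 * (b * n) + 9 * e                ≡⟨ *-distribˡ-+ 9 (b * n) e ⟨
  9 * (b * n + e)                    ∎)
  where
  t : ℕ
  t = ⌈ n /9⌉
  open ≤-Reasoning
  expand : ∀ a t k → 9 * (a * (6 * t + k)) ≡ 6 * a * (9 * t) + 9 * (a * k)
  expand = solve-∀
  regroup : ∀ a b t e → 6 * a * (9 * t) + 9 * (b * t + e) ≡ (6 * a + b) * (9 * t) + 9 * e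
  regroup = solve-∀

⌈/9⌉-induction : ∀ (P : ℕ → Set) n₀ → 1 ≤ n₀ → (∀ n → 1 ≤ n → n ≤ n₀ → P n) →
                 (∀ n → 1 ≤ n → n₀ < n → P ⌈ n /9⌉ → P n) → ∀ n → 1 ≤ n → P n
⌈/9⌉-induction P n₀ 1≤n₀ small large = <-rec (λ n → 1 ≤ n → P n) go
  where
  go : ∀ n → (∀ {m} → m < n → 1 ≤ m → P m) → 1 ≤ n → P n
  go n smaller 1≤n with n ≤? n₀
  ... | yes n≤n₀ = small n 1≤n n≤n₀
  ... | no n≰n₀  = large n 1≤n (≰⇒> n≰n₀)
                     (smaller (⌈n/9⌉<n (≤-trans (s≤s 1≤n₀) (≰⇒> n≰n₀))) (⌈n/9⌉-positive 1≤n))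

K₁-partition : HasPartition 1 1
K₁-partition = ((λ _ _ → zero) , λ _ _ → refl) , λ _ → forest⇒avoiding (edgeless-forest no-edge)
  where
  no-edge : ∀ {a} {x y : Fin 1} → ¬ Adj (λ _ _ → zero) a x y
  no-edge {x = zero} {zero} (x≢y , _) = x≢y refl

partition-within-8n : ∀ n → 1 ≤ n → PartitionWithin 1 8 0 n
partition-within-8n = ⌈/9⌉-induction (PartitionWithin 1 8 0) 1 ≤-refl K₁
  (λ n 1≤n 1<n → grow-within {1} {8} {0} 1≤n (slack 1<n))
  where
  K₁ : ∀ n → 1 ≤ n → n ≤ 1 → PartitionWithin 1 8 0 n
  K₁ n 1≤n n≤1 with ≤-antisym n≤1 1≤n
  ... | refl = 1 , K₁-partition , s≤s z≤n
  slack : ∀ {n} → 2 ≤ n → (6 * 1 + 8) * (n + 8) ≤ 9 * (8 * n)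
  slack {n} 2≤n = begin
    (6 * 1 + 8) * (n + 8)  ≡⟨ *-distribˡ-+ 14 n 8 ⟩
    14 * n + 56 * 2        ≤⟨ +-monoʳ-≤ (14 * n) (*-monoʳ-≤ 56 2≤n) ⟩
    14 * n + 56 * n        ≡⟨ *-distribʳ-+ n 14 56 ⟨
    70 * n                 ≤⟨ *-monoˡ-≤ n (m≤m+n 70 2) ⟩
    72 * n                 ≡⟨ *-assoc 9 8 n ⟩
    9 * (8 * n)            ∎
    where open ≤-Reasoning

within-8n⇒within : ∀ {M n} → n ≤ 14 * M → PartitionWithin 1 8 0 n →
                    PartitionWithin (4 * M) (3 * M + 2) (448 * M * M) n
within-8n⇒within {M} {n} n≤14M (k , P , k≤8n) = k , P , (begin
  4 * M * k                      ≡⟨ cong (4 * M *_) (*-identityˡ k) ⟨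
  4 * M * (1 * k)                ≤⟨ *-monoʳ-≤ (4 * M) k≤8n ⟩
  4 * M * (8 * n + 0)            ≤⟨ *-monoʳ-≤ (4 * M) (+-monoˡ-≤ 0 (*-monoʳ-≤ 8 n≤14M)) ⟩
  4 * M * (8 * (14 * M) + 0)     ≡⟨ collect M ⟩
  448 * M * M                    ≤⟨ m≤n+m (448 * M * M) ((3 * M + 2) * n) ⟩
  (3 * M + 2) * n + 448 * M * M  ∎)
  where
  open ≤-Reasoning
  collect : ∀ M → 4 * M * (8 * (14 * M) + 0) ≡ 448 * M * M
  collect = solve-∀

partition-within : ∀ M → 1 ≤ M → ∀ n → 1 ≤ n → PartitionWithin (4 * M) (3 * M + 2) (448 * M * M) n
partition-within M 1≤M = ⌈/9⌉-induction _ (14 * M) (≤-trans 1≤M (m≤n*m M 14))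
  (λ n 1≤n n≤14M → within-8n⇒within {M} n≤14M (partition-within-8n n 1≤n))
  (λ n 1≤n 14M<n → grow-within {4 * M} {3 * M + 2} {448 * M * M} 1≤n (slack 14M<n))
  where
  slack : ∀ {n} → 14 * M < n → (6 * (4 * M) + (3 * M + 2)) * (n + 8) ≤ 9 * ((3 * M + 2) * n)
  slack {n} 14M<n = begin
    (6 * (4 * M) + (3 * M + 2)) * (n + 8)  ≡⟨ expand M n ⟩
    (27 * M + 2) * n + (216 * M + 16)
      ≤⟨ +-monoʳ-≤ ((27 * M + 2) * n) (+-monoˡ-≤ 16 (*-monoˡ-≤ M (m≤m+n 216 8))) ⟩
    (27 * M + 2) * n + (224 * M + 16)      ≡⟨ cong ((27 * M + 2) * n +_) (factor M) ⟩
    (27 * M + 2) * n + 16 * suc (14 * M)   ≤⟨ +-monoʳ-≤ ((27 * M + 2) * n) (*-monoʳ-≤ 16 14M<n) ⟩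
    (27 * M + 2) * n + 16 * n              ≡⟨ collect M n ⟩
    9 * ((3 * M + 2) * n)                  ∎
    where
    open ≤-Reasoning
    expand : ∀ M n → (6 * (4 * M) + (3 * M + 2)) * (n + 8) ≡ (27 * M + 2) * n + (216 * M + 16)
    expand = solve-∀
    factor : ∀ M → 224 * M + 16 ≡ 16 * suc (14 * M)
    factor = solve-∀
    collect : ∀ M n → (27 * M + 2) * n + 16 * n ≡ 9 * ((3 * M + 2) * n)
    collect = solve-∀

absorb-constant : ∀ {M n e} → e ≤ n → PartitionWithin (4 * M) (3 * M + 2) e n →
                  ∃ λ k → HasPartition n k × 4 * M * k ≤ 3 * M * n + 4 * n
absorb-constant {M} {n} {e} e≤n (k , P , bound) = k , P , (begin
  4 * M * k                  ≤⟨ bound ⟩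
  (3 * M + 2) * n + e        ≤⟨ +-monoʳ-≤ ((3 * M + 2) * n) (≤-trans e≤n (m≤m+n n n)) ⟩
  (3 * M + 2) * n + (n + n)  ≡⟨ regroup M n ⟩
  3 * M * n + 4 * n          ∎)
  where
  open ≤-Reasoning
  regroup : ∀ M n → (3 * M + 2) * n + (n + n) ≡ 3 * M * n + 4 * n
  regroup = solve-∀

scale-lower-bound : ∀ {M n k} → M ≤ n → 3 * n ≤ 4 * k + 3 → 3 * M * n ≤ 4 * M * k + 4 * n
scale-lower-bound {M} {n} {k} M≤n 3n≤4k+3 = begin
  3 * M * n          ≡⟨ *-assoc 3 M n ⟩
  3 * (M * n)        ≡⟨ cong (3 *_) (*-comm M n) ⟩
  3 * (n * M)        ≡⟨ *-assoc 3 n M ⟨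
  3 * n * M          ≤⟨ *-monoˡ-≤ M 3n≤4k+3 ⟩
  (4 * k + 3) * M    ≡⟨ distribute M k ⟩
  4 * M * k + 3 * M  ≤⟨ +-monoʳ-≤ (4 * M * k) (*-mono-≤ (m≤m+n 3 1) M≤n) ⟩
  4 * M * k + 4 * n  ∎
  where
  open ≤-Reasoning
  distribute : ∀ M k → (4 * k + 3) * M ≡ 4 * M * k + 3 * M
  distribute = solve-∀

mainTheorem4 : ∀ (m : ℕ) → ∃ λ N → ∀ n → N ≤ n →
    (∃ λ k → HasPartition n k × 4 * suc m * k ≤ 3 * suc m * n + 4 * n) ×
    (∀ k → HasPartition n k → 3 * suc m * n ≤ 4 * suc m * k + 4 * n)
mainTheorem4 m = N , λ n N≤n →
  absorb-constant {M} N≤n (partition-within M (s≤s z≤n) n (≤-trans (s≤s z≤n) (M≤n N≤n))) ,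
  λ k P → scale-lower-bound {M} {n} {k} (M≤n N≤n) (lower-bound P)
  where
  M N : ℕ
  M = suc m
  N = 448 * M * M
  M≤n : ∀ {n} → N ≤ n → M ≤ n
  M≤n = ≤-trans (≤-trans (m≤n*m M 448) (m≤m*n (448 * M) M))
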